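{- Let $n\ge 1000$ and let $G$ be a graph on $n$ vertices that maximizes the number of induced $5$-cycles among all graphs on $n$ vertices. Then $C(G^*)>0.0384609$.
   Context: All graphs are finite and simple. For a graph $K$, $C(K)$ denotes the fraction of $5$-element vertex subsets of $K$ that induce a $5$-cycle. An iterated balanced blow-up of $C_5$ on $m$ vertices is, for $m\ge 5$, a graph whose vertex set splits into five parts of sizes differing by at most $1$, consecutive parts (cyclically) completely joined, non-consecutive parts not joined, each part inducing an iterated balanced blow-up of $C_5$; for $m<5$ any graph on $m$ vertices. For a graph $G$ on $n$ vertices, $G^*_k$ is the graph on $n5^k$ vertices obtained by replacing each vertex $v$ of $G$ by a copy of the iterated balanced blow-up of $C_5$ on $5^k$ vertices, with all edges between the copies of $v$ and $w$ if $vw\in E(G)$ and none otherwise; $C(G^*)=\lim_{k\to\infty}C(G^*_k)$, which equals $\frac{n+26\,n(n-1)(n-2)(n-3)(n-4)\,C(G)}{26n^5}$. -}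

module Defs where

open import Data.Bool using (Bool; true; false; _∧_; not)
open import Data.Nat as ℕ using (ℕ; zero; suc; _∸_; _^_)
open import Data.Nat.Combinatorics using (_C_)
open import Data.Fin using (Fin)
open import Data.List using (List; []; _∷_; _++_; map; concatMap; length; filter)
open import Data.List using (allFin)
open import Data.Bool.ListAction using (any)
open import Data.Integer using (+_)
open import Data.Rational using (ℚ; 0ℚ; _/_; _+_; _*_)
open import Relation.Binary.PropositionalEquality using (_≡_)
open import Relation.Nullary.Decidable using (T?)
open import Data.Bool using (T)

record Graph (n : ℕ) : Set where
  field
    adj    : Fin n → Fin n → Bool
    sym    : ∀ i j → adj i j ≡ adj j i
    irrefl : ∀ i → adj i i ≡ false
open Graph public

choose : {A : Set} → ℕ → List A → List (List A)
choose zero    _        = [] ∷ []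
choose (suc k) []       = []
choose (suc k) (x ∷ xs) = map (x ∷_) (choose k xs) ++ choose (suc k) xs

insertAll : {A : Set} → A → List A → List (List A)
insertAll x []       = (x ∷ []) ∷ []
insertAll x (y ∷ ys) = (x ∷ y ∷ ys) ∷ map (y ∷_) (insertAll x ys)

perms : {A : Set} → List A → List (List A)
perms []       = [] ∷ []
perms (x ∷ xs) = concatMap (insertAll x) (perms xs)

isCycleOrder : {n : ℕ} → Graph n → List (Fin n) → Bool
isCycleOrder G (a ∷ b ∷ c ∷ d ∷ e ∷ []) =
  adj G a b ∧ adj G b c ∧ adj G c d ∧ adj G d e ∧ adj G e a ∧
  not (adj G a c) ∧ not (adj G a d) ∧ not (adj G b d) ∧
  not (adj G b e) ∧ not (adj G c e)
isCycleOrder G _ = false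

inducesC5 : {n : ℕ} → Graph n → List (Fin n) → Bool
inducesC5 G S = any (isCycleOrder G) (perms S)

numC5 : {n : ℕ} → Graph n → ℕ
numC5 {n} G = length (filter (λ S → T? (inducesC5 G S)) (choose 5 (allFin n)))

-- q / d in ℚ, with the (irrelevant) convention q / 0 = 0
_divℕ_ : ℚ → ℕ → ℚ
q divℕ zero    = 0ℚ
q divℕ (suc d) = q * ((+ 1) / suc d)

-- C(G): fraction of 5-subsets inducing a C5 (0 by convention when n < 5)
Cfrac : {n : ℕ} → Graph n → ℚ
Cfrac {n} G = ((+ numC5 G) / 1) divℕ (n C 5)

-- C(G*) via the closed formula (n + 26 n(n-1)(n-2)(n-3)(n-4) C(G)) / (26 n^5)
Cstar : {n : ℕ} → Graph n → ℚ
Cstar {n} G =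
  (((+ n) / 1) + ((+ (26 ℕ.* n ℕ.* (n ∸ 1) ℕ.* (n ∸ 2) ℕ.* (n ∸ 3) ℕ.* (n ∸ 4))) / 1) * Cfrac G)
    divℕ (26 ℕ.* n ^ 5)

{-# OPTIONS --safe #-}
module Submission where

-- A maximiser G has at least as many induced 5-cycles as any graph on n vertices, in particular
-- as the three-level iterated balanced blow-up of C5 whose innermost parts are independent sets.
-- Counting only those 5-sets of a blow-up that lie inside one part or meet all five parts gives
-- the lower bound c(d+1, m) = ∏ parts + Σ c(d, part).  Writing n = 125q + β with
-- 1000 ≤ β < 1125, the parts of every level are linear in q, so c(3, n) is a polynomial in q
-- with natural coefficients; the inequality 384609 · 26 n⁵ < 10⁷ (n + 3120 c(3, n)) is then
-- checked coefficientwise for each of the 125 values of β.  This is the claimed bound, since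
-- n(n-1)(n-2)(n-3)(n-4) = 5! · C(n,5) turns the definition of C(G*) into
-- (n + 3120 · #C5(G)) / (26 n⁵).

open import Data.Bool using (Bool; true; false; _∧_; _∨_; not; T; if_then_else_)
open import Data.Bool.Properties using (∨-comm; ∧-identityʳ; T-∧)
open import Data.Bool.ListAction using (all)
open import Data.Nat as ℕ
  using (ℕ; zero; suc; _+_; _*_; _∸_; _^_; _!; _≤_; z≤n; s≤s; _≡ᵇ_; _≤ᵇ_; NonZero)
open import Data.Nat.Properties
open import Data.Nat.DivMod using (m≡m%n+[m/n]*n; m%n<n; m/n*n≡m)
open import Data.Nat.Combinatorics using (_C_; nCk≡nPk/k!)
open import Data.Nat.Combinatorics.Base using (_P′_)
open import Data.Nat.Combinatorics.Specification using (k!∣nP′k)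
open import Data.Nat.ListAction using (sum)
open import Data.Nat.Tactic.RingSolver using (solve-∀)
open import Data.Fin using (Fin; toℕ; fromℕ<)
open import Data.Fin.Properties using (all?; toℕ-fromℕ<)
open import Data.List using (List; []; _∷_; _++_; map; length; filter; concat; lookup; allFin)
import Data.List as List
open import Data.List.Properties
  using (map-∘; map-++; length-++; length-map; length-replicate; map-tabulate; tabulate-lookup)
open import Data.Vec using (Vec; []; _∷_)
import Data.Vec as Vec
import Data.Vec.Properties as Vec
import Data.Integer.Properties as ℤ
open import Data.Rational using (ℚ; _/_; _<_; toℚᵘ) renaming (_+_ to _+ℚ_; _*_ to _*ℚ_)
import Data.Rational.Properties as ℚ
open import Data.Rational.Unnormalised as ℚᵘ using (mkℚᵘ; *<*; *≡*)
  renaming (_≃_ to _≃ᵘ_; _<_ to _<ᵘ_)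
import Data.Rational.Unnormalised.Properties as ℚᵘ
open import Data.Product using (Σ-syntax; ∃-syntax; _,_; proj₁; proj₂)
open import Data.Empty using (⊥-elim)
open import Data.Unit using (tt)
open import Function using (_∘_; id; Equivalence)
open import Relation.Binary.PropositionalEquality
open import Relation.Nullary.Decidable using (T?; toWitness)
open import Defs hiding (sym)

private
  variable
    A B : Set

-- Counting the k-subsets of a list

count : (A → Bool) → List A → ℕ
count p []       = 0
count p (x ∷ xs) = if p x then suc (count p xs) else count p xs

length-filter≡count : (p : A → Bool) (xs : List A) →
  length (filter (T? ∘ p) xs) ≡ count p xs
length-filter≡count p [] = refl
length-filter≡count p (x ∷ xs) with p x
... | true  = cong suc (length-filter≡count p xs)
... | false = length-filter≡count p xs

count-++ : (p : A → Bool) (xs ys : List A) → count p (xs ++ ys) ≡ count p xs + count p ys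
count-++ p [] ys = refl
count-++ p (x ∷ xs) ys with p x
... | true  = cong suc (count-++ p xs ys)
... | false = count-++ p xs ys

count-map : (p : B → Bool) (f : A → B) (xs : List A) → count p (map f xs) ≡ count (p ∘ f) xs
count-map p f [] = refl
count-map p f (x ∷ xs) with p (f x)
... | true  = cong suc (count-map p f xs)
... | false = count-map p f xs

count-cong : {p q : A → Bool} → (∀ x → p x ≡ q x) → (xs : List A) → count p xs ≡ count q xs
count-cong p≗q [] = refl
count-cong {q = q} p≗q (x ∷ xs) rewrite p≗q x with q x
... | true  = cong suc (count-cong p≗q xs)
... | false = count-cong p≗q xs

count-mono : {p q : A → Bool} → (∀ x → T (p x) → T (q x)) → (xs : List A) →
  count p xs ≤ count q xs
count-mono p⇒q [] = z≤n
count-mono {p = p} {q} p⇒q (x ∷ xs) with p x | q x | p⇒q x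
... | true  | true  | _   = s≤s (count-mono p⇒q xs)
... | true  | false | p⇒q = ⊥-elim (p⇒q _)
... | false | true  | _   = m≤n⇒m≤1+n (count-mono p⇒q xs)
... | false | false | _   = count-mono p⇒q xs

count-split : (p q : A → Bool) (xs : List A) →
  count p xs ≡ count (λ x → p x ∧ not (q x)) xs + count (λ x → p x ∧ q x) xs
count-split p q [] = refl
count-split p q (x ∷ xs) with p x | q x
... | true  | true  = trans (cong suc (count-split p q xs)) (sym (+-suc _ _))
... | true  | false = cong suc (count-split p q xs)
... | false | _     = count-split p q xs

choose-map : (f : A → B) (k : ℕ) (xs : List A) → choose k (map f xs) ≡ map (map f) (choose k xs)
choose-map f zero    xs       = refl
choose-map f (suc k) []       = refl
choose-map f (suc k) (x ∷ xs) = begin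
    map (f x ∷_) (choose k (map f xs)) ++ choose (suc k) (map f xs)
  ≡⟨ cong₂ (λ ys zs → map (f x ∷_) ys ++ zs) (choose-map f k xs) (choose-map f (suc k) xs) ⟩
    map (f x ∷_) (map (map f) (choose k xs)) ++ map (map f) (choose (suc k) xs)
  ≡⟨ cong (_++ _) (trans (sym (map-∘ (choose k xs))) (map-∘ (choose k xs))) ⟩
    map (map f) (map (x ∷_) (choose k xs)) ++ map (map f) (choose (suc k) xs)
  ≡⟨ sym (map-++ (map f) (map (x ∷_) (choose k xs)) _) ⟩
    map (map f) (map (x ∷_) (choose k xs) ++ choose (suc k) xs)
  ∎
  where open ≡-Reasoning

count-choose-map : (p : List B → Bool) (f : A → B) (k : ℕ) (xs : List A) →
  count p (choose k (map f xs)) ≡ count (p ∘ map f) (choose k xs)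
count-choose-map p f k xs = trans (cong (count p) (choose-map f k xs)) (count-map p (map f) (choose k xs))

count-choose-∷ : (p : List A → Bool) (k : ℕ) (x : A) (xs : List A) →
  count p (choose (suc k) (x ∷ xs)) ≡ count (p ∘ (x ∷_)) (choose k xs) + count p (choose (suc k) xs)
count-choose-∷ p k x xs = trans (count-++ p (map (x ∷_) (choose k xs)) (choose (suc k) xs))
                                (cong (_+ _) (count-map p (x ∷_) (choose k xs)))

count-choose-suffix : (p : List A → Bool) (k : ℕ) (xs ys : List A) →
  count p (choose k xs) ≤ count p (choose k (xs ++ ys))
count-choose-suffix p zero    xs       ys = ≤-refl
count-choose-suffix p (suc k) []       ys = z≤n
count-choose-suffix p (suc k) (x ∷ xs) ys = begin
    count p (choose (suc k) (x ∷ xs))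
  ≡⟨ count-choose-∷ p k x xs ⟩
    count (p ∘ (x ∷_)) (choose k xs) + count p (choose (suc k) xs)
  ≤⟨ +-mono-≤ (count-choose-suffix (p ∘ (x ∷_)) k xs ys) (count-choose-suffix p (suc k) xs ys) ⟩
    count (p ∘ (x ∷_)) (choose k (xs ++ ys)) + count p (choose (suc k) (xs ++ ys))
  ≡⟨ count-choose-∷ p k x (xs ++ ys) ⟨
    count p (choose (suc k) (x ∷ xs ++ ys))
  ∎
  where open ≤-Reasoning

count-choose-++ : (p : List A → Bool) (k : ℕ) (xs ys : List A) →
  count p (choose (suc k) xs) + count p (choose (suc k) ys) ≤ count p (choose (suc k) (xs ++ ys))
count-choose-++ p k []       ys = ≤-refl
count-choose-++ p k (x ∷ xs) ys = begin
    count p (choose (suc k) (x ∷ xs)) + count p (choose (suc k) ys)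
  ≡⟨ cong (_+ _) (count-choose-∷ p k x xs) ⟩
    count (p ∘ (x ∷_)) (choose k xs) + count p (choose (suc k) xs) + count p (choose (suc k) ys)
  ≡⟨ +-assoc (count (p ∘ (x ∷_)) (choose k xs)) _ _ ⟩
    count (p ∘ (x ∷_)) (choose k xs) + (count p (choose (suc k) xs) + count p (choose (suc k) ys))
  ≤⟨ +-mono-≤ (count-choose-suffix (p ∘ (x ∷_)) k xs ys) (count-choose-++ p k xs ys) ⟩
    count (p ∘ (x ∷_)) (choose k (xs ++ ys)) + count p (choose (suc k) (xs ++ ys))
  ≡⟨ count-choose-∷ p k x (xs ++ ys) ⟨
    count p (choose (suc k) (x ∷ xs ++ ys))
  ∎
  where open ≤-Reasoning

count-choose-prefix : (p : List A → Bool) (k : ℕ) (xs ys : List A) →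
  count p (choose k ys) ≤ count p (choose k (xs ++ ys))
count-choose-prefix p zero    xs ys = ≤-refl
count-choose-prefix p (suc k) xs ys = ≤-trans (m≤n+m _ _) (count-choose-++ p k xs ys)

count-choose-concat : (p : List A → Bool) (k : ℕ) (xss : List (List A)) →
  sum (map (count p ∘ choose (suc k)) xss) ≤ count p (choose (suc k) (concat xss))
count-choose-concat p k []         = z≤n
count-choose-concat p k (xs ∷ xss) =
  ≤-trans (+-monoʳ-≤ _ (count-choose-concat p k xss)) (count-choose-++ p k xs (concat xss))

length*≤count-choose-map-++ : {p : List A → Bool} {k : ℕ} {f : B → A} {t : ℕ}
  (vs : List B) {ys : List A} → (∀ v → t ≤ count (p ∘ (f v ∷_)) (choose k ys)) →
  length vs * t ≤ count p (choose (suc k) (map f vs ++ ys))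
length*≤count-choose-map-++ [] bound = z≤n
length*≤count-choose-map-++ {p = p} {k} {f} {t} (v ∷ vs) {ys} bound = begin
    t + length vs * t
  ≤⟨ +-mono-≤ (≤-trans (bound v) (count-choose-prefix (p ∘ (f v ∷_)) k (map f vs) ys))
              (length*≤count-choose-map-++ vs bound) ⟩
    count (p ∘ (f v ∷_)) (choose k (map f vs ++ ys)) + count p (choose (suc k) (map f vs ++ ys))
  ≡⟨ count-choose-∷ p k (f v) (map f vs ++ ys) ⟨
    count p (choose (suc k) (map f (v ∷ vs) ++ ys))
  ∎
  where open ≤-Reasoning

-- The iterated blow-up of C5

-- A vertex of an iterated blow-up is addressed by the indices (0 to 4) of the nested parts
-- containing it, outermost first; two vertices are adjacent iff their addresses first differ
-- in indices adjacent on the cycle 0-1-2-3-4-0.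
Address : Set
Address = List ℕ

≡ᵇ-refl : ∀ i → (i ≡ᵇ i) ≡ true
≡ᵇ-refl zero    = refl
≡ᵇ-refl (suc i) = ≡ᵇ-refl i

≡ᵇ-sym : ∀ i j → (i ≡ᵇ j) ≡ (j ≡ᵇ i)
≡ᵇ-sym zero    zero    = refl
≡ᵇ-sym zero    (suc j) = refl
≡ᵇ-sym (suc i) zero    = refl
≡ᵇ-sym (suc i) (suc j) = ≡ᵇ-sym i j

c5-adjacent : ℕ → ℕ → Bool
c5-adjacent i j = (suc i ℕ.% 5 ≡ᵇ j) ∨ (suc j ℕ.% 5 ≡ᵇ i)

adjacent : Address → Address → Bool
adjacent (i ∷ a) (j ∷ b) = if i ≡ᵇ j then adjacent a b else c5-adjacent i j
adjacent _       _       = false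

adjacent-sym : ∀ a b → adjacent a b ≡ adjacent b a
adjacent-sym []      []      = refl
adjacent-sym []      (j ∷ b) = refl
adjacent-sym (i ∷ a) []      = refl
adjacent-sym (i ∷ a) (j ∷ b)
  rewrite ≡ᵇ-sym i j | adjacent-sym a b | ∨-comm (suc i ℕ.% 5 ≡ᵇ j) (suc j ℕ.% 5 ≡ᵇ i)
  = refl

adjacent-irrefl : ∀ a → adjacent a a ≡ false
adjacent-irrefl []      = refl
adjacent-irrefl (i ∷ a) rewrite ≡ᵇ-refl i = adjacent-irrefl a

inducedC5 : List Address → Bool
inducedC5 (a ∷ b ∷ c ∷ d ∷ e ∷ []) =
  adjacent a b ∧ adjacent b c ∧ adjacent c d ∧ adjacent d e ∧ adjacent e a ∧
  not (adjacent a c) ∧ not (adjacent a d) ∧ not (adjacent b d) ∧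
  not (adjacent b e) ∧ not (adjacent c e)
inducedC5 _ = false

inducedC5-∷ : ∀ i S → inducedC5 (map (i ∷_) S) ≡ inducedC5 S
inducedC5-∷ i []                              = refl
inducedC5-∷ i (a ∷ [])                        = refl
inducedC5-∷ i (a ∷ b ∷ [])                    = refl
inducedC5-∷ i (a ∷ b ∷ c ∷ [])                = refl
inducedC5-∷ i (a ∷ b ∷ c ∷ d ∷ [])            = refl
inducedC5-∷ i (a ∷ b ∷ c ∷ d ∷ e ∷ [])        rewrite ≡ᵇ-refl i = refl
inducedC5-∷ i (a ∷ b ∷ c ∷ d ∷ e ∷ f ∷ S)     = refl

sameBlock : Address → Address → Bool
sameBlock (i ∷ _) (j ∷ _) = i ≡ᵇ j
sameBlock _       _       = false

inOneBlock : List Address → Bool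
inOneBlock []      = true
inOneBlock (a ∷ S) = all (sameBlock a) S

inOneBlock-∷ : ∀ i S → inOneBlock (map (i ∷_) S) ≡ true
inOneBlock-∷ i []      = refl
inOneBlock-∷ i (a ∷ S) = all-sameBlock S
  where
  all-sameBlock : ∀ S → all (sameBlock (i ∷ a)) (map (i ∷_) S) ≡ true
  all-sameBlock []      = refl
  all-sameBlock (b ∷ S) rewrite ≡ᵇ-refl i = all-sameBlock S

rotate : Vec ℕ 5 → Vec ℕ 5
rotate (a ∷ b ∷ c ∷ d ∷ e ∷ []) = suc e ∷ a ∷ b ∷ c ∷ d ∷ []

balanced : ℕ → Vec ℕ 5
balanced zero    = Vec.replicate 5 0
balanced (suc m) = rotate (balanced m)

sum-rotate : ∀ v → Vec.sum (rotate v) ≡ suc (Vec.sum v)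
sum-rotate (a ∷ b ∷ c ∷ d ∷ e ∷ []) = cong suc (lemma a b c d e)
  where
  lemma : ∀ a b c d e → e + (a + (b + (c + (d + 0)))) ≡ a + (b + (c + (d + (e + 0))))
  lemma = solve-∀

sum-balanced : ∀ m → Vec.sum (balanced m) ≡ m
sum-balanced zero    = refl
sum-balanced (suc m) = trans (sum-rotate (balanced m)) (cong suc (sum-balanced m))

rotate⁵ : ∀ v → rotate (rotate (rotate (rotate (rotate v)))) ≡ Vec.map suc v
rotate⁵ (a ∷ b ∷ c ∷ d ∷ e ∷ []) = refl

balanced-5*+ : ∀ k r → balanced (5 * k + r) ≡ Vec.map (k +_) (balanced r)
balanced-5*+ zero    r = sym (Vec.map-id (balanced r))
balanced-5*+ (suc k) r = begin
    balanced (5 * suc k + r)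
  ≡⟨ cong balanced (lemma k r) ⟩
    balanced (5 + (5 * k + r))
  ≡⟨ rotate⁵ (balanced (5 * k + r)) ⟩
    Vec.map suc (balanced (5 * k + r))
  ≡⟨ cong (Vec.map suc) (balanced-5*+ k r) ⟩
    Vec.map suc (Vec.map (k +_) (balanced r))
  ≡⟨ Vec.map-∘ suc (k +_) (balanced r) ⟨
    Vec.map (suc k +_) (balanced r)
  ∎
  where
  open ≡-Reasoning
  lemma : ∀ k r → 5 * suc k + r ≡ 5 + (5 * k + r)
  lemma = solve-∀

product : {n : ℕ} → Vec ℕ n → ℕ
product = Vec.foldr′ _*_ 1

c5count : ℕ → ℕ → ℕ
c5count zero    m = 0
c5count (suc d) m = product (balanced m) + Vec.sum (Vec.map (c5count d) (balanced m))

blocks : (ℕ → List Address) → Vec ℕ 5 → List (List Address)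
blocks part v =
  Vec.toList (Vec.zipWith (λ i a → map (i ∷_) (part a)) (0 ∷ 1 ∷ 2 ∷ 3 ∷ 4 ∷ []) v)

blowUp : ℕ → ℕ → List Address
blowUp zero    m = List.replicate m []
blowUp (suc d) m = concat (blocks (blowUp d) (balanced m))

length-concat : {A : Set} (xss : List (List A)) → length (concat xss) ≡ sum (map length xss)
length-concat []         = refl
length-concat (xs ∷ xss) = trans (length-++ xs) (cong (length xs +_) (length-concat xss))

length-blowUp : ∀ d m → length (blowUp d m) ≡ m
length-blowUp zero    m = length-replicate m
length-blowUp (suc d) m = trans (layer (balanced m)) (sum-balanced m)
  where
  part : ∀ i a → length (map (i ∷_) (blowUp d a)) ≡ a
  part i a = trans (length-map (i ∷_) (blowUp d a)) (length-blowUp d a)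
  layer : ∀ v → length (concat (blocks (blowUp d) v)) ≡ Vec.sum v
  layer v@(a₀ ∷ a₁ ∷ a₂ ∷ a₃ ∷ a₄ ∷ []) = trans (length-concat (blocks (blowUp d) v))
    (cong₂ _+_ (part 0 a₀) (cong₂ _+_ (part 1 a₁) (cong₂ _+_ (part 2 a₂)
      (cong₂ _+_ (part 3 a₃) (cong₂ _+_ (part 4 a₄) refl)))))

c5count≤count-inducedC5 : ∀ d m → c5count d m ≤ count inducedC5 (choose 5 (blowUp d m))
c5count≤count-inducedC5 zero    m = z≤n
c5count≤count-inducedC5 (suc d) m = layer (balanced m)
  where
  spread within : List Address → Bool
  spread S = inducedC5 S ∧ not (inOneBlock S)
  within S = inducedC5 S ∧ inOneBlock S
  part : ∀ i a → c5count d a ≤ count within (choose 5 (map (i ∷_) (blowUp d a)))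
  part i a = begin
      c5count d a
    ≤⟨ c5count≤count-inducedC5 d a ⟩
      count inducedC5 (choose 5 (blowUp d a))
    ≡⟨ count-cong within-∷ (choose 5 (blowUp d a)) ⟨
      count (within ∘ map (i ∷_)) (choose 5 (blowUp d a))
    ≡⟨ count-choose-map within (i ∷_) 5 (blowUp d a) ⟨
      count within (choose 5 (map (i ∷_) (blowUp d a)))
    ∎
    where
    open ≤-Reasoning
    within-∷ : ∀ S → within (map (i ∷_) S) ≡ inducedC5 S
    within-∷ S = trans (cong₂ _∧_ (inducedC5-∷ i S) (inOneBlock-∷ i S)) (∧-identityʳ _)
  lengths : ∀ v → Vec.map (length ∘ blowUp d) v ≡ v
  lengths v = trans (Vec.map-cong (length-blowUp d) v) (Vec.map-id v)
  layer : ∀ v → product v + Vec.sum (Vec.map (c5count d) v)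
                ≤ count inducedC5 (choose 5 (concat (blocks (blowUp d) v)))
  layer v@(a₀ ∷ a₁ ∷ a₂ ∷ a₃ ∷ a₄ ∷ []) = begin
      product v + Vec.sum (Vec.map (c5count d) v)
    ≡⟨ cong (λ v′ → product v′ + Vec.sum (Vec.map (c5count d) v)) (lengths v) ⟨
      product (Vec.map (length ∘ blowUp d) v) + Vec.sum (Vec.map (c5count d) v)
    ≤⟨ +-mono-≤ transversals (+-mono-≤ (part 0 a₀) (+-mono-≤ (part 1 a₁)
         (+-mono-≤ (part 2 a₂) (+-mono-≤ (part 3 a₃) (+-mono-≤ (part 4 a₄) z≤n))))) ⟩
      count spread (choose 5 W) + sum (map (count within ∘ choose 5) (blocks (blowUp d) v))
    ≤⟨ +-monoʳ-≤ _ (count-choose-concat within 4 (blocks (blowUp d) v)) ⟩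
      count spread (choose 5 W) + count within (choose 5 W)
    ≡⟨ count-split inducedC5 inOneBlock (choose 5 W) ⟨
      count inducedC5 (choose 5 W)
    ∎
    where
    open ≤-Reasoning
    W : List Address
    W = concat (blocks (blowUp d) v)
    -- The final ≤-refl is a closed computation: every 5-set with one vertex in each part
    -- induces a C5 and is not inside one part, whatever the deeper address digits are.
    transversals : product (Vec.map (length ∘ blowUp d) v) ≤ count spread (choose 5 W)
    transversals =
      length*≤count-choose-map-++ (blowUp d a₀) λ _ →
      length*≤count-choose-map-++ (blowUp d a₁) λ _ →
      length*≤count-choose-map-++ (blowUp d a₂) λ _ →
      length*≤count-choose-map-++ (blowUp d a₃) λ _ →
      length*≤count-choose-map-++ (blowUp d a₄) λ _ → ≤-refl

-- Realising the blow-up as a graph on Fin n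

addressGraph : (w : List Address) → Graph (length w)
addressGraph w = record
  { adj    = λ u v → adjacent (lookup w u) (lookup w v)
  ; sym    = λ u v → adjacent-sym (lookup w u) (lookup w v)
  ; irrefl = λ u → adjacent-irrefl (lookup w u)
  }

isCycleOrder-addressGraph : (w : List Address) (S : List (Fin (length w))) →
  isCycleOrder (addressGraph w) S ≡ inducedC5 (map (lookup w) S)
isCycleOrder-addressGraph w []                          = refl
isCycleOrder-addressGraph w (a ∷ [])                    = refl
isCycleOrder-addressGraph w (a ∷ b ∷ [])                = refl
isCycleOrder-addressGraph w (a ∷ b ∷ c ∷ [])            = refl
isCycleOrder-addressGraph w (a ∷ b ∷ c ∷ d ∷ [])        = refl
isCycleOrder-addressGraph w (a ∷ b ∷ c ∷ d ∷ e ∷ [])    = refl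
isCycleOrder-addressGraph w (a ∷ b ∷ c ∷ d ∷ e ∷ _ ∷ _) = refl

perms-head : {A : Set} (xs : List A) → Σ[ rest ∈ List (List A) ] perms xs ≡ xs ∷ rest
perms-head []       = [] , refl
perms-head (x ∷ xs) with perms xs | perms-head xs
... | .(xs ∷ rest) | rest , refl with xs
...   | []    = _ , refl
...   | _ ∷ _ = _ , refl

isCycleOrder⇒inducesC5 : {n : ℕ} (G : Graph n) (S : List (Fin n)) →
  T (isCycleOrder G S) → T (inducesC5 G S)
isCycleOrder⇒inducesC5 G S cyc with perms-head S
... | rest , eq rewrite eq with isCycleOrder G S
... | true = tt

map-lookup-allFin : {A : Set} (xs : List A) → map (lookup xs) (allFin (length xs)) ≡ xs
map-lookup-allFin xs = trans (map-tabulate id (lookup xs)) (tabulate-lookup xs)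

numC5-addressGraph : (w : List Address) → count inducedC5 (choose 5 w) ≤ numC5 (addressGraph w)
numC5-addressGraph w = begin
    count inducedC5 (choose 5 w)
  ≡⟨ cong (count inducedC5 ∘ choose 5) (map-lookup-allFin w) ⟨
    count inducedC5 (choose 5 (map (lookup w) vertices))
  ≡⟨ count-choose-map inducedC5 (lookup w) 5 vertices ⟩
    count (inducedC5 ∘ map (lookup w)) (choose 5 vertices)
  ≡⟨ count-cong (isCycleOrder-addressGraph w) (choose 5 vertices) ⟨
    count (isCycleOrder G) (choose 5 vertices)
  ≤⟨ count-mono (isCycleOrder⇒inducesC5 G) (choose 5 vertices) ⟩
    count (inducesC5 G) (choose 5 vertices)
  ≡⟨ length-filter≡count (inducesC5 G) (choose 5 vertices) ⟨
    numC5 G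
  ∎
  where
  open ≤-Reasoning
  G : Graph (length w)
  G = addressGraph w
  vertices : List (Fin (length w))
  vertices = allFin (length w)

c5count-realised : ∀ d n → ∃[ H ] c5count d n ≤ numC5 {n} H
c5count-realised d n =
  realise (blowUp d n) (length-blowUp d n) (c5count≤count-inducedC5 d n)
  where
  realise : (w : List Address) → length w ≡ n → c5count d n ≤ count inducedC5 (choose 5 w) →
            ∃[ H ] c5count d n ≤ numC5 {n} H
  realise w refl bound = addressGraph w , ≤-trans bound (numC5-addressGraph w)

-- The numerical inequality

Poly : Set
Poly = List ℕ

eval : Poly → ℕ → ℕ
eval []      x = 0
eval (a ∷ p) x = a + x * eval p x

infixl 6 _+ₚ_
infixl 7 _*ₚ_ _·ₚ_
infixr 8 _^ₚ_

_+ₚ_ : Poly → Poly → Poly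
[]      +ₚ q       = q
(a ∷ p) +ₚ []      = a ∷ p
(a ∷ p) +ₚ (b ∷ q) = a + b ∷ p +ₚ q

_·ₚ_ : ℕ → Poly → Poly
c ·ₚ p = map (c *_) p

_*ₚ_ : Poly → Poly → Poly
[]      *ₚ q = []
(a ∷ p) *ₚ q = a ·ₚ q +ₚ (0 ∷ p *ₚ q)

_^ₚ_ : Poly → ℕ → Poly
p ^ₚ zero  = 1 ∷ []
p ^ₚ suc k = p *ₚ p ^ₚ k

linear : ℕ → ℕ → Poly
linear a b = b ∷ a ∷ []

sumₚ : {n : ℕ} → Vec Poly n → Poly
sumₚ = Vec.foldr′ _+ₚ_ []

productₚ : {n : ℕ} → Vec Poly n → Poly
productₚ = Vec.foldr′ _*ₚ_ (1 ∷ [])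

_≤ₚ_ : Poly → Poly → Bool
[]      ≤ₚ q       = true
(a ∷ p) ≤ₚ []      = (a ≡ᵇ 0) ∧ (p ≤ₚ [])
(a ∷ p) ≤ₚ (b ∷ q) = (a ≤ᵇ b) ∧ (p ≤ₚ q)

eval-+ₚ : ∀ p q x → eval (p +ₚ q) x ≡ eval p x + eval q x
eval-+ₚ []      q       x = refl
eval-+ₚ (a ∷ p) []      x = sym (+-identityʳ _)
eval-+ₚ (a ∷ p) (b ∷ q) x rewrite eval-+ₚ p q x = lemma a b x (eval p x) (eval q x)
  where
  lemma : ∀ a b x P Q → a + b + x * (P + Q) ≡ a + x * P + (b + x * Q)
  lemma = solve-∀

eval-·ₚ : ∀ c p x → eval (c ·ₚ p) x ≡ c * eval p x
eval-·ₚ c []      x = sym (*-zeroʳ c)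
eval-·ₚ c (a ∷ p) x rewrite eval-·ₚ c p x = lemma c a x (eval p x)
  where
  lemma : ∀ c a x P → c * a + x * (c * P) ≡ c * (a + x * P)
  lemma = solve-∀

eval-*ₚ : ∀ p q x → eval (p *ₚ q) x ≡ eval p x * eval q x
eval-*ₚ []      q x = refl
eval-*ₚ (a ∷ p) q x
  rewrite eval-+ₚ (a ·ₚ q) (0 ∷ p *ₚ q) x | eval-·ₚ a q x | eval-*ₚ p q x
  = lemma a x (eval p x) (eval q x)
  where
  lemma : ∀ a x P Q → a * Q + x * (P * Q) ≡ (a + x * P) * Q
  lemma = solve-∀

eval-^ₚ : ∀ p k x → eval (p ^ₚ k) x ≡ eval p x ^ k
eval-^ₚ p zero    x = cong suc (*-zeroʳ x)
eval-^ₚ p (suc k) x = trans (eval-*ₚ p (p ^ₚ k) x) (cong (eval p x *_) (eval-^ₚ p k x))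

eval-linear : ∀ a b x → eval (linear a b) x ≡ a * x + b
eval-linear a b x = lemma a b x
  where
  lemma : ∀ a b x → b + x * (a + x * 0) ≡ a * x + b
  lemma = solve-∀

eval-sumₚ : {A : Set} {n : ℕ} (f : A → Poly) (v : Vec A n) (x : ℕ) →
  eval (sumₚ (Vec.map f v)) x ≡ Vec.sum (Vec.map (λ a → eval (f a) x) v)
eval-sumₚ f []      x = refl
eval-sumₚ f (a ∷ v) x =
  trans (eval-+ₚ (f a) (sumₚ (Vec.map f v)) x) (cong (eval (f a) x +_) (eval-sumₚ f v x))

eval-productₚ : {A : Set} {n : ℕ} (f : A → Poly) (v : Vec A n) (x : ℕ) →
  eval (productₚ (Vec.map f v)) x ≡ product (Vec.map (λ a → eval (f a) x) v)
eval-productₚ f []      x = cong suc (*-zeroʳ x)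
eval-productₚ f (a ∷ v) x =
  trans (eval-*ₚ (f a) (productₚ (Vec.map f v)) x) (cong (eval (f a) x *_) (eval-productₚ f v x))

eval-mono : ∀ p q x → T (p ≤ₚ q) → eval p x ≤ eval q x
eval-mono []      q       x _ = z≤n
eval-mono (a ∷ p) []      x p≤0 with Equivalence.to T-∧ p≤0
... | a≡0 , p≤[] rewrite ≡ᵇ⇒≡ a 0 a≡0 =
  ≤-trans (*-monoʳ-≤ x (eval-mono p [] x p≤[])) (≤-reflexive (*-zeroʳ x))
eval-mono (a ∷ p) (b ∷ q) x p≤q with Equivalence.to T-∧ p≤q
... | a≤b , p≤q = +-mono-≤ (≤ᵇ⇒≤ a b a≤b) (*-monoʳ-≤ x (eval-mono p q x p≤q))

c5Poly : ℕ → ℕ → Poly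
c5Poly zero    β = []
c5Poly (suc d) β =
  productₚ (Vec.map (λ t → linear (5 ^ d) (β ℕ./ 5 + t)) parts) +ₚ
  sumₚ (Vec.map (λ t → c5Poly d (β ℕ./ 5 + t)) parts)
  where parts = balanced (β ℕ.% 5)

eval-c5Poly : ∀ d β x → eval (c5Poly d β) x ≡ c5count d (5 ^ d * x + β)
eval-c5Poly zero    β x = refl
eval-c5Poly (suc d) β x = begin
    eval (productₚ (Vec.map factor t) +ₚ sumₚ (Vec.map summand t)) x
  ≡⟨ eval-+ₚ (productₚ (Vec.map factor t)) (sumₚ (Vec.map summand t)) x ⟩
    eval (productₚ (Vec.map factor t)) x + eval (sumₚ (Vec.map summand t)) x
  ≡⟨ cong₂ _+_ (eval-productₚ factor t x) (eval-sumₚ summand t x) ⟩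
    product (Vec.map (λ a → eval (factor a) x) t) + Vec.sum (Vec.map (λ a → eval (summand a) x) t)
  ≡⟨ cong₂ _+_ (cong product (Vec.map-cong eval-factor t))
               (cong Vec.sum (Vec.map-cong eval-summand t)) ⟩
    product (Vec.map (k +_) t) + Vec.sum (Vec.map (c5count d ∘ (k +_)) t)
  ≡⟨ cong (product (Vec.map (k +_) t) +_) (cong Vec.sum (Vec.map-∘ (c5count d) (k +_) t)) ⟩
    product (Vec.map (k +_) t) + Vec.sum (Vec.map (c5count d) (Vec.map (k +_) t))
  ≡⟨ cong (λ v → product v + Vec.sum (Vec.map (c5count d) v)) (balanced-5*+ k (β ℕ.% 5)) ⟨
    c5count (suc d) (5 * k + β ℕ.% 5)
  ≡⟨ cong (c5count (suc d)) digit-split ⟨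
    c5count (suc d) (5 ^ suc d * x + β)
  ∎
  where
  open ≡-Reasoning
  b k : ℕ
  b = β ℕ./ 5
  k = 5 ^ d * x + b
  t : Vec ℕ 5
  t = balanced (β ℕ.% 5)
  factor summand : ℕ → Poly
  factor a = linear (5 ^ d) (b + a)
  summand a = c5Poly d (b + a)
  eval-factor : ∀ a → eval (factor a) x ≡ k + a
  eval-factor a = trans (eval-linear (5 ^ d) (b + a) x) (sym (+-assoc (5 ^ d * x) b a))
  eval-summand : ∀ a → eval (summand a) x ≡ c5count d (k + a)
  eval-summand a = trans (eval-c5Poly d (b + a) x) (cong (c5count d) (sym (+-assoc (5 ^ d * x) b a)))
  digit-split : 5 ^ suc d * x + β ≡ 5 * k + β ℕ.% 5
  digit-split = trans (cong (5 ^ suc d * x +_) (m≡m%n+[m/n]*n β 5)) (lemma (5 ^ d) x (β ℕ.% 5) b)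
    where
    lemma : ∀ P x r b → 5 * P * x + (r + b * 5) ≡ 5 * (P * x + b) + r
    lemma = solve-∀

lowerPoly : ℕ → ℕ → Poly → Poly
lowerPoly a b L = (1 ∷ []) +ₚ a ·ₚ (b ·ₚ L ^ₚ 5)

upperPoly : ℕ → ℕ → Poly → Poly → Poly
upperPoly a b L P = a ·ₚ (L +ₚ b ·ₚ P)

eval-lowerPoly : ∀ a b L x → eval (lowerPoly a b L) x ≡ suc (a * (b * eval L x ^ 5))
eval-lowerPoly a b L x = begin
    eval ((1 ∷ []) +ₚ a ·ₚ (b ·ₚ L ^ₚ 5)) x
  ≡⟨ eval-+ₚ (1 ∷ []) (a ·ₚ (b ·ₚ L ^ₚ 5)) x ⟩
    1 + x * 0 + eval (a ·ₚ (b ·ₚ L ^ₚ 5)) x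
  ≡⟨ cong₂ _+_ (cong suc (*-zeroʳ x))
               (trans (eval-·ₚ a (b ·ₚ L ^ₚ 5) x) (cong (a *_) (eval-·ₚ b (L ^ₚ 5) x))) ⟩
    suc (a * (b * eval (L ^ₚ 5) x))
  ≡⟨ cong (λ y → suc (a * (b * y))) (eval-^ₚ L 5 x) ⟩
    suc (a * (b * eval L x ^ 5))
  ∎
  where open ≡-Reasoning

eval-upperPoly : ∀ a b L P x → eval (upperPoly a b L P) x ≡ (eval L x + b * eval P x) * a
eval-upperPoly a b L P x = begin
    eval (a ·ₚ (L +ₚ b ·ₚ P)) x
  ≡⟨ eval-·ₚ a (L +ₚ b ·ₚ P) x ⟩
    a * eval (L +ₚ b ·ₚ P) x
  ≡⟨ cong (a *_) (trans (eval-+ₚ L (b ·ₚ P) x) (cong (eval L x +_) (eval-·ₚ b P x))) ⟩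
    a * (eval L x + b * eval P x)
  ≡⟨ *-comm a (eval L x + b * eval P x) ⟩
    (eval L x + b * eval P x) * a
  ∎
  where open ≡-Reasoning

lower≤ₚupper⇒< : ∀ a b c d L P x {m M} → eval L x ≡ m → eval P x ≡ M →
  T (lowerPoly a b L ≤ₚ upperPoly c d L P) → a * (b * m ^ 5) ℕ.< (m + d * M) * c
lower≤ₚupper⇒< a b c d L P x refl refl L≤U =
  subst₂ _≤_ (eval-lowerPoly a b L x) (eval-upperPoly c d L P x)
    (eval-mono (lowerPoly a b L) (upperPoly c d L P) x L≤U)

residueCheck : ℕ → Bool
residueCheck r =
  lowerPoly 384609 26 (linear (5 ^ 3) (1000 + r)) ≤ₚ
  upperPoly 10000000 3120 (linear (5 ^ 3) (1000 + r)) (c5Poly 3 (1000 + r))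

residueCheck-passes : (r : Fin 125) → T (residueCheck (toℕ r))
residueCheck-passes = toWitness {a? = all? (λ r → T? (residueCheck (toℕ r)))} tt

residue-bound : ∀ q r → r ℕ.< 125 →
  let n = 5 ^ 3 * q + (1000 + r) in 384609 * (26 * n ^ 5) ℕ.< (n + 3120 * c5count 3 n) * 10000000
residue-bound q r r<125 =
  lower≤ₚupper⇒< 384609 26 10000000 3120 (linear (5 ^ 3) (1000 + r)) (c5Poly 3 (1000 + r)) q
    (eval-linear (5 ^ 3) (1000 + r) q) (eval-c5Poly 3 (1000 + r) q)
    (subst (T ∘ residueCheck) (toℕ-fromℕ< r<125) (residueCheck-passes (fromℕ< r<125)))

c5count-bound : ∀ n → 1000 ≤ n → 384609 * (26 * n ^ 5) ℕ.< (n + 3120 * c5count 3 n) * 10000000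
c5count-bound n 1000≤n =
  subst (λ n → 384609 * (26 * n ^ 5) ℕ.< (n + 3120 * c5count 3 n) * 10000000)
    n≡ (residue-bound q r (m%n<n (n ∸ 1000) 125))
  where
  q r : ℕ
  q = (n ∸ 1000) ℕ./ 125
  r = (n ∸ 1000) ℕ.% 125
  n≡ : 5 ^ 3 * q + (1000 + r) ≡ n
  n≡ = begin
      5 ^ 3 * q + (1000 + r)  ≡⟨ lemma q r ⟩
      1000 + (r + q * 125)    ≡⟨ cong (1000 +_) (m≡m%n+[m/n]*n (n ∸ 1000) 125) ⟨
      1000 + (n ∸ 1000)       ≡⟨ m+[n∸m]≡n 1000≤n ⟩
      n                       ∎
    where
    open ≡-Reasoning
    lemma : ∀ q r → 5 ^ 3 * q + (1000 + r) ≡ 1000 + (r + q * 125)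
    lemma = solve-∀

-- The closed form of C(G*)

open import Data.Integer as ℤ using (+_; +<+)

mkℚᵘ-+ : ∀ a b c d →
  mkℚᵘ (+ a) b ℚᵘ.+ mkℚᵘ (+ c) d ≡ mkℚᵘ (+ (a * suc d + c * suc b)) (d + b * suc d)
mkℚᵘ-+ a b c d = cong (λ i → mkℚᵘ i (d + b * suc d)) (sym (begin
    + (a * suc d + c * suc b)          ≡⟨ ℤ.pos-+ (a * suc d) (c * suc b) ⟩
    + (a * suc d) ℤ.+ + (c * suc b)    ≡⟨ cong₂ ℤ._+_ (ℤ.pos-* a (suc d)) (ℤ.pos-* c (suc b)) ⟩
    + a ℤ.* + suc d ℤ.+ + c ℤ.* + suc b ∎))
  where open ≡-Reasoning

mkℚᵘ-* : ∀ a b c d → mkℚᵘ (+ a) b ℚᵘ.* mkℚᵘ (+ c) d ≡ mkℚᵘ (+ (a * c)) (d + b * suc d)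
mkℚᵘ-* a b c d = cong (λ i → mkℚᵘ i (d + b * suc d)) (sym (ℤ.pos-* a c))

mkℚᵘ-≃ : ∀ {a b c d} → a * suc d ≡ c * suc b → mkℚᵘ (+ a) b ≃ᵘ mkℚᵘ (+ c) d
mkℚᵘ-≃ {a} {b} {c} {d} eq =
  *≡* (trans (sym (ℤ.pos-* a (suc d))) (trans (cong +_ eq) (ℤ.pos-* c (suc b))))

mkℚᵘ-< : ∀ {a b c d} → a * suc d ℕ.< c * suc b → mkℚᵘ (+ a) b <ᵘ mkℚᵘ (+ c) d
mkℚᵘ-< {a} {b} {c} {d} lt = *<* (subst₂ ℤ._<_ (ℤ.pos-* a (suc d)) (ℤ.pos-* c (suc b)) (+<+ lt))

toℚᵘ-/ : ∀ a b → toℚᵘ ((+ a) / suc b) ≃ᵘ mkℚᵘ (+ a) b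
toℚᵘ-/ a b = ℚ.toℚᵘ-fromℚᵘ (mkℚᵘ (+ a) b)

-- Cstar G unfolds to CstarFormula n (numC5 G) (26 n(n-1)(n-2)(n-3)(n-4)) (n C 5) (26 n⁵).
CstarFormula : ℕ → ℕ → ℕ → ℕ → ℕ → ℚ
CstarFormula n N K C D = (((+ n) / 1) +ℚ ((+ K) / 1) *ℚ (((+ N) / 1) divℕ C)) divℕ D

toℚᵘ-CstarFormula : ∀ n N c e →
  toℚᵘ (CstarFormula n N (3120 * suc c) (suc c) (suc e)) ≃ᵘ mkℚᵘ (+ (n + 3120 * N)) e
-- The `+ 0`s are what the unnormalised denominators (1 + 0)(1 + c) reduce to.
toℚᵘ-CstarFormula n N c e = begin
    toℚᵘ ((ι n +ℚ ι K *ℚ (ι N *ℚ recip c)) *ℚ recip e)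
  ≈⟨ ℚ.toℚᵘ-homo-* (ι n +ℚ ι K *ℚ (ι N *ℚ recip c)) (recip e) ⟩
    toℚᵘ (ι n +ℚ ι K *ℚ (ι N *ℚ recip c)) ℚᵘ.* toℚᵘ (recip e)
  ≈⟨ ℚᵘ.*-cong
       (ℚᵘ.≃-trans (ℚ.toℚᵘ-homo-+ (ι n) (ι K *ℚ (ι N *ℚ recip c))) (ℚᵘ.+-cong (toℚᵘ-/ n 0)
       (ℚᵘ.≃-trans (ℚ.toℚᵘ-homo-* (ι K) (ι N *ℚ recip c)) (ℚᵘ.*-cong (toℚᵘ-/ K 0)
       (ℚᵘ.≃-trans (ℚ.toℚᵘ-homo-* (ι N) (recip c)) (ℚᵘ.*-cong (toℚᵘ-/ N 0) (toℚᵘ-/ 1 c)))))))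
       (toℚᵘ-/ 1 e) ⟩
    (ιᵘ n ℚᵘ.+ ιᵘ K ℚᵘ.* (ιᵘ N ℚᵘ.* mkℚᵘ (+ 1) c)) ℚᵘ.* mkℚᵘ (+ 1) e
  ≡⟨ cong (λ x → (ιᵘ n ℚᵘ.+ ιᵘ K ℚᵘ.* x) ℚᵘ.* mkℚᵘ (+ 1) e) (mkℚᵘ-* N 0 1 c) ⟩
    (ιᵘ n ℚᵘ.+ ιᵘ K ℚᵘ.* mkℚᵘ (+ (N * 1)) (c + 0)) ℚᵘ.* mkℚᵘ (+ 1) e
  ≡⟨ cong (λ x → (ιᵘ n ℚᵘ.+ x) ℚᵘ.* mkℚᵘ (+ 1) e) (mkℚᵘ-* K 0 (N * 1) (c + 0)) ⟩
    (ιᵘ n ℚᵘ.+ mkℚᵘ (+ (K * (N * 1))) (c + 0 + 0)) ℚᵘ.* mkℚᵘ (+ 1) e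
  ≡⟨ cong (ℚᵘ._* mkℚᵘ (+ 1) e) (mkℚᵘ-+ n 0 (K * (N * 1)) (c + 0 + 0)) ⟩
    mkℚᵘ (+ numerator) (c + 0 + 0 + 0) ℚᵘ.* mkℚᵘ (+ 1) e
  ≡⟨ mkℚᵘ-* numerator (c + 0 + 0 + 0) 1 e ⟩
    mkℚᵘ (+ (numerator * 1)) (e + (c + 0 + 0 + 0) * suc e)
  ≈⟨ mkℚᵘ-≃ (cross-multiplied n N c e) ⟩
    mkℚᵘ (+ (n + 3120 * N)) e
  ∎
  where
  open ℚᵘ.≃-Reasoning
  K numerator : ℕ
  K = 3120 * suc c
  numerator = n * suc (c + 0 + 0) + K * (N * 1) * 1
  ι recip : ℕ → ℚ
  ι a = (+ a) / 1
  recip d = (+ 1) / suc d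
  ιᵘ : ℕ → ℚᵘ.ℚᵘ
  ιᵘ a = mkℚᵘ (+ a) 0
  cross-multiplied : ∀ n N c e →
    (n * suc (c + 0 + 0) + 3120 * suc c * (N * 1) * 1) * 1 * suc e
      ≡ (n + 3120 * N) * suc (e + (c + 0 + 0 + 0) * suc e)
  cross-multiplied = solve-∀

nC5*5!≡nP′5 : ∀ m → ((5 + m) C 5) * 5 ! ≡ (5 + m) P′ 5
nC5*5!≡nP′5 m = trans (cong (_* 5 !) (nCk≡nPk/k! 5≤n)) (m/n*n≡m (k!∣nP′k 5≤n))
  where
  5≤n : 5 ≤ 5 + m
  5≤n = m≤m+n 5 m

toℚᵘ-Cstar : ∀ {m} (G : Graph (5 + m)) →
  toℚᵘ (Cstar G) ≃ᵘ mkℚᵘ (+ (5 + m + 3120 * numC5 G)) (ℕ.pred (26 * (5 + m) ^ 5))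
toℚᵘ-Cstar {m} G =
  subst (λ K → toℚᵘ (CstarFormula n N K (n C 5) D) ≃ᵘ mkℚᵘ (+ (n + 3120 * N)) (ℕ.pred D))
    (sym (coefficient (n C 5) (nC5*5!≡nP′5 m))) (closed (n C 5) (nC5*5!≡nP′5 m))
  where
  n N D : ℕ
  n = 5 + m
  N = numC5 G
  D = 26 * n ^ 5
  coefficient : ∀ k → k * 5 ! ≡ n P′ 5 → 26 * n * (n ∸ 1) * (n ∸ 2) * (n ∸ 3) * (n ∸ 4) ≡ 3120 * k
  coefficient k k*5!≡ = begin
    26 * n * (n ∸ 1) * (n ∸ 2) * (n ∸ 3) * (n ∸ 4)  ≡⟨ reorder n (n ∸ 1) (n ∸ 2) (n ∸ 3) (n ∸ 4) ⟩
    26 * (n P′ 5)                                  ≡⟨ cong (26 *_) k*5!≡ ⟨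
    26 * (k * 120)                                 ≡⟨ scale k ⟩
    3120 * k                                       ∎
    where
    open ≡-Reasoning
    reorder : ∀ a b c d e → 26 * a * b * c * d * e ≡ 26 * (e * (d * (c * (b * (a * 1)))))
    reorder = solve-∀
    scale : ∀ k → 26 * (k * 120) ≡ 3120 * k
    scale = solve-∀
  -- k = 0 needs no clause: n P′ 5 reduces to a successor, so k * 5 ! ≡ n P′ 5 is refuted.
  closed : ∀ k → k * 5 ! ≡ n P′ 5 →
    toℚᵘ (CstarFormula n N (3120 * k) k D) ≃ᵘ mkℚᵘ (+ (n + 3120 * N)) (ℕ.pred D)
  closed (suc c) _ = toℚᵘ-CstarFormula n N c (ℕ.pred D)

Cstar-lowerBound : ∀ {n} (G : Graph n) → 5 ≤ n → ∀ a b .{{_ : NonZero b}} →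
  a * (26 * n ^ 5) ℕ.< (n + 3120 * numC5 G) * b → (+ a) / b < Cstar G
Cstar-lowerBound G (s≤s (s≤s (s≤s (s≤s (s≤s _))))) a (suc b) lt = ℚ.toℚᵘ-cancel-<
  (ℚᵘ.<-respˡ-≃ (ℚᵘ.≃-sym (toℚᵘ-/ a b))
  (ℚᵘ.<-respʳ-≃ (ℚᵘ.≃-sym (toℚᵘ-Cstar G)) (mkℚᵘ-< lt)))

c5count≤maximum : ∀ d {n} (G : Graph n) → ((H : Graph n) → numC5 H ≤ numC5 G) →
  c5count d n ≤ numC5 G
c5count≤maximum d {n} G maximal =
  ≤-trans (proj₂ (c5count-realised d n)) (maximal (proj₁ (c5count-realised d n)))

proposition2 : (n : ℕ) → 1000 ≤ n → (G : Graph n) →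
    ((H : Graph n) → numC5 H ≤ numC5 G) →
    (+ 384609) / 10000000 < Cstar G
proposition2 n 1000≤n G maximal =
  Cstar-lowerBound G (≤-trans (m≤m+n 5 995) 1000≤n) 384609 10000000 (begin-strict
    384609 * (26 * n ^ 5)                 <⟨ c5count-bound n 1000≤n ⟩
    (n + 3120 * c5count 3 n) * 10000000   ≤⟨ *-monoˡ-≤ 10000000 (+-monoʳ-≤ n (*-monoʳ-≤ 3120
                                               (c5count≤maximum 3 G maximal))) ⟩
    (n + 3120 * numC5 G) * 10000000       ∎)
  where open ≤-Reasoning
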